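{- For every integer $n$, $$\sum_{k=0}^{\infty}a_7^+\bigl(n-14k(3k-1)-1\bigr)+\sum_{k=1}^{\infty}a_7^+\bigl(n-14k(3k+1)-1\bigr)\equiv\begin{cases}1\pmod 2 & \text{if } n=2l(3l-1)\text{ or } n=2l(3l+1)\text{ for some integer } l\ge 0,\\ 0\pmod 2 & \text{otherwise.}\end{cases}$$ (The sums are finite since only finitely many arguments are $\ge -1$.)
   Context: Let $q=e^{2\pi i z}$ with $z$ in the upper half-plane, and $\eta(z)=q^{1/24}\prod_{n\ge1}(1-q^n)$. Define the integers $a_7^+(n)$ by $\left(\frac{\eta(z)}{\eta(7z)}\right)^{4}=\sum_{n\ge -1}a_7^+(n)q^n$, with $a_7^+(n)=0$ for $n<-1$. -}

module Defs where

open import Data.Nat as ℕ using (ℕ; zero; suc; _∸_)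
open import Data.Nat.Divisibility as ND using ()
open import Data.Integer using (ℤ; +_; -[1+_]; _+_; _*_; _-_; ∣_∣)
open import Relation.Nullary.Decidable using (does)
open import Data.Bool using (if_then_else_)

-- formal power series in q with integer coefficients: coefficient functions
Series : Set
Series = ℕ → ℤ

sumTo : ℕ → (ℕ → ℤ) → ℤ
sumTo zero    f = + 0
sumTo (suc n) f = sumTo n f + f n

conv : Series → Series → Series
conv f g N = sumTo (suc N) (λ i → f i * g (N ∸ i))

unitS : Series
unitS N = if does (N ℕ.≟ 0) then + 1 else + 0

pow4 : Series → Series
pow4 f = conv f (conv f (conv f f))

oneMinus : ℕ → Series
oneMinus m N = unitS N - (if does (N ℕ.≟ m) then + 1 else + 0)

-- 1/(1 - q^m) = Σ_j q^{m j}   (used only with m ≥ 1)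
geom : ℕ → Series
geom m N = if does (m ND.∣? N) then + 1 else + 0

-- factor for index m = suc k :  (1 - q^m)^4 / (1 - q^{7m})^4
factor : ℕ → Series
factor k = conv (pow4 (oneMinus (suc k))) (pow4 (geom (7 ℕ.* suc k)))

prodTo : ℕ → Series
prodTo zero    = unitS
prodTo (suc K) = conv (prodTo K) (factor K)

-- coefficient of q^N in ∏_{m≥1} (1 - q^m)^4/(1 - q^{7m})^4
-- (factors with m > N are 1 + O(q^m), so truncating at m = N is exact)
prodCoef : ℕ → ℤ
prodCoef N = prodTo N N

-- (η(z)/η(7z))^4 = q^{-1} ∏_{m≥1} (1-q^m)^4/(1-q^{7m})^4 = Σ_{n≥-1} a₇⁺(n) q^n
a7+ : ℤ → ℤ
a7+ (+ N)          = prodCoef (suc N)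
a7+ -[1+ zero ]    = prodCoef 0
a7+ -[1+ suc _ ]   = + 0

penM : ℕ → ℤ
penM k = + 14 * + k * (+ 3 * + k - + 1)

penP : ℕ → ℤ
penP k = + 14 * + k * (+ 3 * + k + + 1)

-- For k > |n| the arguments are < -1 (since 14k(3k∓1) ≥ k), so the terms vanish;
-- summing k < |n| + 1 (resp. 1 ≤ k < |n| + 1) gives the full infinite sums.
lhsSum : ℤ → ℤ
lhsSum n = sumTo (suc ∣ n ∣) (λ k → a7+ (n - penM k - + 1))
         + sumTo (suc ∣ n ∣) (λ k → a7+ (n - penP (suc k) - + 1))

module Submission where

-- Everything is reduced modulo 2, i.e. to power series over GF(2) = (Bool, xor, ∧).  Write
-- P = ∏_{m≥1} (1-q^m)⁴/(1-q^{7m})⁴, so that a₇⁺(n) = [q^{n+1}] P.  Over GF(2) the Frobenius map gives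
-- (1-q^m)⁴ = 1 + q^{4m} and (1-q^{7m})⁴ = 1 + q^{28m}, hence  P · ∏(1 + q^{28m}) = ∏(1 + q^{4m}).
-- By Euler's pentagonal theorem mod 2,  ∏_{m≥1}(1 + q^{cm}) = Σ_{k≥0} q^{c k(3k-1)/2} + Σ_{k≥1} q^{c k(3k+1)/2}.
-- With c = 28 on the left, [q^n] of the product is the theorem's left-hand side mod 2; with c = 4 on the
-- right, it is 1 exactly when n = 4·k(3k∓1)/2 = 2k(3k∓1).  All products are truncated at m = K, which
-- fixes every coefficient of degree ≤ K, and the pentagonal theorem is used in Shanks' finite form
--   ∏_{m=1}^{n}(1 + q^{cm}) = Σ_{k=0}^{n} q^{c(kn + k(k+1)/2)} ∏_{m=k+1}^{n}(1 + q^{cm})   (mod 2),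
-- proved by induction on n; the right-hand side is the truncated pentagonal series.

module XorSums where
  open import Data.Nat using (ℕ; zero; suc; _+_; _∸_; _<_; _≤_; _≟_)
  open import Data.Nat.Properties
    using (≤-refl; ≤-pred; m≤n⇒m≤1+n; <-≤-trans; <⇒≢; ≤∧≢⇒<; +-suc; +-identityʳ; n∸n≡0; +-∸-assoc; m+[n∸m]≡n)
  open import Data.Bool using (Bool; false; _∧_; _xor_)
  open import Data.Bool.Properties
    using (xor-comm; xor-assoc; xor-identityʳ; xor-same; ∧-comm; ∧-zeroʳ; ∧-distribˡ-xor; xor-∧-commutativeRing)
  open import Algebra.Bundles using (CommutativeRing)
  open import Algebra.Properties.CommutativeSemigroup
    (CommutativeRing.+-commutativeSemigroup xor-∧-commutativeRing) using (interchange)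
  open import Relation.Binary.PropositionalEquality
  open import Relation.Nullary using (yes; no)
  open ≡-Reasoning

  xor-interchange : ∀ a b c d → (a xor b) xor (c xor d) ≡ (a xor c) xor (b xor d)
  xor-interchange = interchange

  xor-cancelʳ : ∀ u w → (u xor w) xor w ≡ u
  xor-cancelʳ u w = begin
    (u xor w) xor w ≡⟨ xor-assoc u w w ⟩
    u xor (w xor w) ≡⟨ cong (u xor_) (xor-same w) ⟩
    u xor false     ≡⟨ xor-identityʳ u ⟩
    u               ∎

  xor-cancel-middle : ∀ x y z → (x xor y) xor (y xor z) ≡ x xor z
  xor-cancel-middle x y z = begin
    (x xor y) xor (y xor z) ≡⟨ xor-assoc x y (y xor z) ⟩
    x xor (y xor (y xor z)) ≡⟨ cong (x xor_) (xor-assoc y y z) ⟨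
    x xor ((y xor y) xor z) ≡⟨ cong (λ w → x xor (w xor z)) (xor-same y) ⟩
    x xor z                 ∎

  xor-cancelˡ : ∀ a s z → (a xor s) xor (a xor z) ≡ s xor z
  xor-cancelˡ a s z = trans (cong (_xor (a xor z)) (xor-comm a s)) (xor-cancel-middle s a z)

  xorSum : ℕ → (ℕ → Bool) → Bool
  xorSum zero    f = false
  xorSum (suc n) f = xorSum n f xor f n

  xorSum-cong : ∀ n {f g} → (∀ i → i < n → f i ≡ g i) → xorSum n f ≡ xorSum n g
  xorSum-cong zero    h = refl
  xorSum-cong (suc n) h = cong₂ _xor_ (xorSum-cong n (λ i i<n → h i (m≤n⇒m≤1+n i<n))) (h n ≤-refl)

  xorSum-zero : ∀ n {f} → (∀ i → i < n → f i ≡ false) → xorSum n f ≡ false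
  xorSum-zero zero    h = refl
  xorSum-zero (suc n) h rewrite xorSum-zero n (λ i i<n → h i (m≤n⇒m≤1+n i<n)) = h n ≤-refl

  xorSum-xor : ∀ n f g → xorSum n (λ i → f i xor g i) ≡ xorSum n f xor xorSum n g
  xorSum-xor zero    f g = refl
  xorSum-xor (suc n) f g rewrite xorSum-xor n f g = xor-interchange (xorSum n f) (xorSum n g) (f n) (g n)

  ∧-xorSum : ∀ n x f → x ∧ xorSum n f ≡ xorSum n (λ i → x ∧ f i)
  ∧-xorSum zero    x f = ∧-zeroʳ x
  ∧-xorSum (suc n) x f rewrite ∧-distribˡ-xor x (xorSum n f) (f n) | ∧-xorSum n x f = refl

  xorSum-∧ : ∀ n x f → xorSum n f ∧ x ≡ xorSum n (λ i → f i ∧ x)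
  xorSum-∧ n x f = trans (∧-comm (xorSum n f) x) (trans (∧-xorSum n x f) (xorSum-cong n (λ i _ → ∧-comm x (f i))))

  xorSum-front : ∀ n f → xorSum (suc n) f ≡ f 0 xor xorSum n (λ i → f (suc i))
  xorSum-front zero    f = sym (xor-identityʳ (f 0))
  xorSum-front (suc n) f rewrite xorSum-front n f = xor-assoc (f 0) _ _

  xorSum-single≥ : ∀ n a f → (∀ i → i ≢ a → f i ≡ false) → n ≤ a → xorSum n f ≡ false
  xorSum-single≥ n a f h n≤a = xorSum-zero n (λ i i<n → h i (<⇒≢ (<-≤-trans i<n n≤a)))

  xorSum-single< : ∀ n a f → (∀ i → i ≢ a → f i ≡ false) → a < n → xorSum n f ≡ f a
  xorSum-single< (suc n) a f h a<1+n with a ≟ n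
  ... | yes refl rewrite xorSum-single≥ n a f h ≤-refl = refl
  ... | no a≢n rewrite xorSum-single< n a f h (≤∧≢⇒< (≤-pred a<1+n) a≢n) | h n (λ n≡a → a≢n (sym n≡a)) =
    xor-identityʳ (f a)

  xorSum-reverse : ∀ n f → xorSum n f ≡ xorSum n (λ i → f (n ∸ suc i))
  xorSum-reverse zero    f = refl
  xorSum-reverse (suc n) f = begin
    xorSum n f xor f n                     ≡⟨ cong (_xor f n) (xorSum-reverse n f) ⟩
    xorSum n (λ i → f (n ∸ suc i)) xor f n ≡⟨ xor-comm _ (f n) ⟩
    f n xor xorSum n (λ i → f (n ∸ suc i)) ≡⟨ xorSum-front n (λ i → f (suc n ∸ suc i)) ⟨
    xorSum (suc n) (λ i → f (suc n ∸ suc i)) ∎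

  xorSum-swap : ∀ a b (H : ℕ → ℕ → Bool) →
    xorSum a (λ i → xorSum b (H i)) ≡ xorSum b (λ k → xorSum a (λ i → H i k))
  xorSum-swap zero    b H = sym (xorSum-zero b (λ _ _ → refl))
  xorSum-swap (suc a) b H rewrite xorSum-swap a b H = sym (xorSum-xor b (λ k → xorSum a (λ i → H i k)) (H a))

  xorSum-triangle : ∀ N (F : ℕ → ℕ → Bool) →
    xorSum (suc N) (λ i → xorSum (suc i) (F i)) ≡ xorSum (suc N) (λ j → xorSum (suc (N ∸ j)) (λ t → F (j + t) j))
  xorSum-triangle zero    F = refl
  xorSum-triangle (suc N) F = begin
    xorSum (suc N) (λ i → xorSum (suc i) (F i)) xor xorSum (suc (suc N)) (F (suc N))
      ≡⟨ cong (_xor xorSum (suc (suc N)) (F (suc N))) (xorSum-triangle N F) ⟩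
    Inner N xor (xorSum (suc N) (F (suc N)) xor F (suc N) (suc N))
      ≡⟨ xor-assoc (Inner N) _ _ ⟨
    (Inner N xor xorSum (suc N) (F (suc N))) xor F (suc N) (suc N)
      ≡⟨ cong (_xor F (suc N) (suc N)) (xorSum-xor (suc N) (λ j → xorSum (suc (N ∸ j)) (λ t → F (j + t) j)) (F (suc N))) ⟨
    xorSum (suc N) (λ j → xorSum (suc (N ∸ j)) (λ t → F (j + t) j) xor F (suc N) j) xor F (suc N) (suc N)
      ≡⟨ cong₂ _xor_ (xorSum-cong (suc N) extend) (cong₂ F (sym (+-identityʳ (suc N))) refl) ⟩
    Inner (suc N) xor F (suc N + 0) (suc N)
      ≡⟨ cong (λ k → Inner (suc N) xor xorSum (suc k) (λ t → F (suc N + t) (suc N))) (n∸n≡0 N) ⟨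
    xorSum (suc (suc N)) (λ j → xorSum (suc (suc N ∸ j)) (λ t → F (j + t) j)) ∎
    where
    Inner : ℕ → Bool
    Inner M = xorSum (suc N) (λ j → xorSum (suc (M ∸ j)) (λ t → F (j + t) j))
    -- the column of index j gains the summand t = N + 1 - j
    extend : ∀ j → j < suc N →
      xorSum (suc (N ∸ j)) (λ t → F (j + t) j) xor F (suc N) j ≡ xorSum (suc (suc N ∸ j)) (λ t → F (j + t) j)
    extend j j<1+N rewrite +-∸-assoc 1 (≤-pred j<1+N) =
      cong (λ k → xorSum (suc (N ∸ j)) (λ t → F (j + t) j) xor F k j)
           (sym (trans (+-suc j (N ∸ j)) (cong suc (m+[n∸m]≡n (≤-pred j<1+N)))))

module Series₂ where
  open import Level using (0ℓ)
  open import Data.Nat using (ℕ; suc; _+_; _∸_; _<_; _≤_; _≟_; _≤?_; s≤s; z≤n)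
  open import Data.Nat.Properties
    using (≤-pred; ≰⇒>; m≤m+n; m∸n≤m; m∸[m∸n]≡n; m+n∸m≡n; m+[n∸m]≡n; ∸-+-assoc)
  open import Data.Bool using (Bool; true; false; _∧_; _xor_)
  open import Data.Bool.Properties using (∧-comm; ∧-assoc; ∧-distribˡ-xor)
  open import Relation.Binary.Bundles using (Setoid)
  import Relation.Binary.Reasoning.Setoid as SetoidReasoning
  open import Relation.Binary.PropositionalEquality
  open import Relation.Nullary using (does; yes; no)
  open import Relation.Nullary.Decidable using (dec-true; dec-false)
  open XorSums

  Series₂ : Set
  Series₂ = ℕ → Bool

  infix  4 _≈_
  infixl 6 _⊕_
  infixl 7 _·_

  _≈_ : Series₂ → Series₂ → Set
  f ≈ g = ∀ N → f N ≡ g N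

  _⊕_ : Series₂ → Series₂ → Series₂
  (f ⊕ g) N = f N xor g N

  _·_ : Series₂ → Series₂ → Series₂
  (f · g) N = xorSum (suc N) (λ i → f i ∧ g (N ∸ i))

  q^_ : ℕ → Series₂
  (q^ a) N = does (N ≟ a)

  ≈-refl : ∀ {f} → f ≈ f
  ≈-refl N = refl

  ≈-sym : ∀ {f g} → f ≈ g → g ≈ f
  ≈-sym f≈g N = sym (f≈g N)

  ≈-trans : ∀ {f g h} → f ≈ g → g ≈ h → f ≈ h
  ≈-trans f≈g g≈h N = trans (f≈g N) (g≈h N)

  ≈-setoid : Setoid 0ℓ 0ℓ
  ≈-setoid = record
    { Carrier       = Series₂
    ; _≈_           = _≈_
    ; isEquivalence = record { refl = ≈-refl ; sym = ≈-sym ; trans = ≈-trans }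
    }

  module ≈-Reasoning = SetoidReasoning ≈-setoid

  ⊕-cong : ∀ {f f′ g g′} → f ≈ f′ → g ≈ g′ → f ⊕ g ≈ f′ ⊕ g′
  ⊕-cong f≈f′ g≈g′ N = cong₂ _xor_ (f≈f′ N) (g≈g′ N)

  ·-cong : ∀ {f f′ g g′} → f ≈ f′ → g ≈ g′ → f · g ≈ f′ · g′
  ·-cong f≈f′ g≈g′ N = xorSum-cong (suc N) (λ i _ → cong₂ _∧_ (f≈f′ i) (g≈g′ (N ∸ i)))

  ·-congˡ : ∀ {f f′} g → f ≈ f′ → f · g ≈ f′ · g
  ·-congˡ g f≈f′ = ·-cong f≈f′ (≈-refl {g})

  ·-congʳ : ∀ f {g g′} → g ≈ g′ → f · g ≈ f · g′
  ·-congʳ f g≈g′ = ·-cong (≈-refl {f}) g≈g′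

  ·-cong-upTo : ∀ f {g g′} N → (∀ j → j ≤ N → g j ≡ g′ j) → (f · g) N ≡ (f · g′) N
  ·-cong-upTo f N g≡g′ = xorSum-cong (suc N) (λ i _ → cong (f i ∧_) (g≡g′ (N ∸ i) (m∸n≤m N i)))

  ·-comm : ∀ f g → f · g ≈ g · f
  ·-comm f g N = begin
    xorSum (suc N) (λ i → f i ∧ g (N ∸ i))             ≡⟨ xorSum-reverse (suc N) _ ⟩
    xorSum (suc N) (λ i → f (N ∸ i) ∧ g (N ∸ (N ∸ i))) ≡⟨ xorSum-cong (suc N) flip ⟩
    xorSum (suc N) (λ i → g i ∧ f (N ∸ i))             ∎
    where
    open ≡-Reasoning
    flip : ∀ i → i < suc N → f (N ∸ i) ∧ g (N ∸ (N ∸ i)) ≡ g i ∧ f (N ∸ i)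
    flip i i<1+N = trans (cong (λ j → f (N ∸ i) ∧ g j) (m∸[m∸n]≡n (≤-pred i<1+N))) (∧-comm (f (N ∸ i)) (g i))

  ·-distribˡ : ∀ f g h → f · (g ⊕ h) ≈ f · g ⊕ f · h
  ·-distribˡ f g h N =
    trans (xorSum-cong (suc N) (λ i _ → ∧-distribˡ-xor (f i) (g (N ∸ i)) (h (N ∸ i)))) (xorSum-xor (suc N) _ _)

  ·-distribʳ : ∀ f g h → (g ⊕ h) · f ≈ g · f ⊕ h · f
  ·-distribʳ f g h = begin
    (g ⊕ h) · f   ≈⟨ ·-comm (g ⊕ h) f ⟩
    f · (g ⊕ h)   ≈⟨ ·-distribˡ f g h ⟩
    f · g ⊕ f · h ≈⟨ ⊕-cong (·-comm f g) (·-comm f h) ⟩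
    g · f ⊕ h · f ∎
    where open ≈-Reasoning

  ·-assoc : ∀ f g h → (f · g) · h ≈ f · (g · h)
  ·-assoc f g h N = begin
    xorSum (suc N) (λ i → xorSum (suc i) (λ j → f j ∧ g (i ∸ j)) ∧ h (N ∸ i))
      ≡⟨ xorSum-cong (suc N) (λ i _ → xorSum-∧ (suc i) (h (N ∸ i)) _) ⟩
    xorSum (suc N) (λ i → xorSum (suc i) (λ j → (f j ∧ g (i ∸ j)) ∧ h (N ∸ i)))
      ≡⟨ xorSum-triangle N (λ i j → (f j ∧ g (i ∸ j)) ∧ h (N ∸ i)) ⟩
    xorSum (suc N) (λ j → xorSum (suc (N ∸ j)) (λ t → (f j ∧ g (j + t ∸ j)) ∧ h (N ∸ (j + t))))
      ≡⟨ xorSum-cong (suc N) (λ j _ → trans (xorSum-cong (suc (N ∸ j)) (λ t _ → reindex j t))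
                                              (sym (∧-xorSum (suc (N ∸ j)) (f j) _))) ⟩
    xorSum (suc N) (λ j → f j ∧ xorSum (suc (N ∸ j)) (λ t → g t ∧ h (N ∸ j ∸ t))) ∎
    where
    open ≡-Reasoning
    reindex : ∀ j t → (f j ∧ g (j + t ∸ j)) ∧ h (N ∸ (j + t)) ≡ f j ∧ (g t ∧ h (N ∸ j ∸ t))
    reindex j t = trans (cong₂ (λ u v → (f j ∧ g u) ∧ h v) (m+n∸m≡n j t) (sym (∸-+-assoc N j t)))
                        (∧-assoc (f j) (g t) (h (N ∸ j ∸ t)))

  ·-xorSum : ∀ n f (g : ℕ → Series₂) N → xorSum n (λ k → (f · g k) N) ≡ (f · (λ j → xorSum n (λ k → g k j))) N
  ·-xorSum n f g N = sym (trans (xorSum-cong (suc N) (λ i _ → ∧-xorSum n (f i) (λ k → g k (N ∸ i))))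
                                (xorSum-swap (suc N) n (λ i k → f i ∧ g k (N ∸ i))))

  ·-interchange : ∀ a b c d → (a · b) · (c · d) ≈ (a · c) · (b · d)
  ·-interchange a b c d = begin
    (a · b) · (c · d) ≈⟨ ·-assoc a b (c · d) ⟩
    a · (b · (c · d)) ≈⟨ ·-congʳ a (·-assoc b c d) ⟨
    a · ((b · c) · d) ≈⟨ ·-congʳ a (·-congˡ d (·-comm b c)) ⟩
    a · ((c · b) · d) ≈⟨ ·-congʳ a (·-assoc c b d) ⟩
    a · (c · (b · d)) ≈⟨ ·-assoc a c (b · d) ⟨
    (a · c) · (b · d) ∎
    where open ≈-Reasoning

  ·-swapʳ : ∀ x y z → (x · y) · z ≈ (x · z) · y
  ·-swapʳ x y z = begin
    (x · y) · z ≈⟨ ·-assoc x y z ⟩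
    x · (y · z) ≈⟨ ·-congʳ x (·-comm y z) ⟩
    x · (z · y) ≈⟨ ·-assoc x z y ⟨
    (x · z) · y ∎
    where open ≈-Reasoning

  q^-cong : ∀ {a b} → a ≡ b → q^ a ≈ q^ b
  q^-cong refl = ≈-refl

  q^-≢ : ∀ a N → N ≢ a → (q^ a) N ≡ false
  q^-≢ a N N≢a = dec-false (N ≟ a) N≢a

  q^-≡ : ∀ a → (q^ a) a ≡ true
  q^-≡ a = dec-true (a ≟ a) refl

  q^-·-≥ : ∀ a f N → a ≤ N → (q^ a · f) N ≡ f (N ∸ a)
  q^-·-≥ a f N a≤N = trans (xorSum-single< (suc N) a _ (λ i i≢a → cong (_∧ f (N ∸ i)) (q^-≢ a i i≢a)) (s≤s a≤N))
                           (cong (_∧ f (N ∸ a)) (q^-≡ a))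

  q^-·-< : ∀ a f N → N < a → (q^ a · f) N ≡ false
  q^-·-< a f N N<a = xorSum-single≥ (suc N) a _ (λ i i≢a → cong (_∧ f (N ∸ i)) (q^-≢ a i i≢a)) N<a

  ·-q^-≥ : ∀ a f N → a ≤ N → (f · q^ a) N ≡ f (N ∸ a)
  ·-q^-≥ a f N a≤N = trans (·-comm f (q^ a) N) (q^-·-≥ a f N a≤N)

  ·-q^-< : ∀ a f N → N < a → (f · q^ a) N ≡ false
  ·-q^-< a f N N<a = trans (·-comm f (q^ a) N) (q^-·-< a f N N<a)

  ·-identityˡ : ∀ f → q^ 0 · f ≈ f
  ·-identityˡ f N = q^-·-≥ 0 f N z≤n

  ·-identityʳ : ∀ f → f · q^ 0 ≈ f
  ·-identityʳ f N = ·-q^-≥ 0 f N z≤n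

  q^-·-q^ : ∀ a b → q^ a · q^ b ≈ q^ (a + b)
  q^-·-q^ a b N with a ≤? N
  ... | yes a≤N = trans (q^-·-≥ a (q^ b) N a≤N) (shift (N ≟ a + b))
    where
    shift : ∀ d → does (N ∸ a ≟ b) ≡ does d
    shift (yes N≡a+b) = dec-true (N ∸ a ≟ b) (trans (cong (_∸ a) N≡a+b) (m+n∸m≡n a b))
    shift (no N≢a+b)  = dec-false (N ∸ a ≟ b) (λ e → N≢a+b (trans (sym (m+[n∸m]≡n a≤N)) (cong (a +_) e)))
  ... | no a≰N = trans (q^-·-< a (q^ b) N (≰⇒> a≰N))
                       (sym (q^-≢ (a + b) N (λ N≡a+b → a≰N (subst (a ≤_) (sym N≡a+b) (m≤m+n a b)))))

module Frobenius where
  open import Data.Nat using (ℕ; zero; suc; _+_; _*_; _∸_; _<_; _≤_; _≤?_; s≤s; z≤n)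
  open import Data.Nat.Properties using (<⇒≢; <⇒≱; <-≤-trans; ≰⇒>; m+[n∸m]≡n; +-identityʳ)
  open import Data.Nat.Divisibility using (_∣_; _∣?_; ∣m+n∣m⇒∣n; ∣m∸n∣n⇒∣m; ∣-refl; _∣0; ∣⇒≤)
  open import Data.Nat.Tactic.RingSolver using (solve-∀)
  open import Data.Bool using (false; _xor_)
  open import Data.Bool.Properties using (xor-same; xor-identityʳ)
  open import Relation.Binary.PropositionalEquality
  open import Relation.Nullary using (Dec; does; yes; no)
  open import Relation.Nullary.Decidable using (dec-true; dec-false)
  open XorSums
  open Series₂

  infix 8 _² _⁴

  _² : Series₂ → Series₂
  f ² = f · f

  -- the fourth power, associated as in the definition of pow4 in Defs
  _⁴ : Series₂ → Series₂
  f ⁴ = f · (f · (f · f))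

  ⁴-cong : ∀ {f g} → f ≈ g → f ⁴ ≈ g ⁴
  ⁴-cong f≈g = ·-cong f≈g (·-cong f≈g (·-cong f≈g f≈g))

  ⁴≈²² : ∀ f → f ⁴ ≈ (f ²) ²
  ⁴≈²² f = ≈-sym (·-assoc f f (f ²))

  ²-hom : ∀ f g → (f · g) ² ≈ f ² · g ²
  ²-hom f g = ·-interchange f g f g

  ⁴-hom : ∀ f g → (f · g) ⁴ ≈ f ⁴ · g ⁴
  ⁴-hom f g = begin
    (f · g) ⁴             ≈⟨ ⁴≈²² (f · g) ⟩
    ((f · g) ²) ²         ≈⟨ ·-cong (²-hom f g) (²-hom f g) ⟩
    (f ² · g ²) ²         ≈⟨ ²-hom (f ²) (g ²) ⟩
    (f ²) ² · (g ²) ²     ≈⟨ ·-cong (⁴≈²² f) (⁴≈²² g) ⟨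
    f ⁴ · g ⁴             ∎
    where open ≈-Reasoning

  ⁴-identity : (q^ 0) ⁴ ≈ q^ 0
  ⁴-identity = ≈-trans (·-identityˡ _) (≈-trans (·-identityˡ _) (·-identityˡ _))

  -- the binomial 1 + q^a  (equal to 1 - q^a over GF(2))
  one+q^_ : ℕ → Series₂
  one+q^ a = q^ 0 ⊕ q^ a

  one+q^-cong : ∀ {a b} → a ≡ b → one+q^ a ≈ one+q^ b
  one+q^-cong refl = ≈-refl

  one+q^-·-q^ : ∀ a X → one+q^ a · q^ X ≈ q^ X ⊕ q^ (a + X)
  one+q^-·-q^ a X = ≈-trans (·-distribʳ (q^ X) (q^ 0) (q^ a)) (⊕-cong (·-identityˡ (q^ X)) (q^-·-q^ a X))

  one+q^-² : ∀ a → (one+q^ a) ² ≈ one+q^ (a + a)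
  one+q^-² a N = begin
    (one+q^ a · one+q^ a) N                        ≡⟨ ·-distribʳ (one+q^ a) (q^ 0) (q^ a) N ⟩
    (q^ 0 · one+q^ a) N xor (q^ a · one+q^ a) N
      ≡⟨ cong₂ _xor_ (·-identityˡ (one+q^ a) N) (·-distribˡ (q^ a) (q^ 0) (q^ a) N) ⟩
    (one+q^ a) N xor ((q^ a · q^ 0) N xor (q^ a · q^ a) N)
      ≡⟨ cong ((one+q^ a) N xor_) (cong₂ _xor_ (trans (q^-·-q^ a 0 N) (q^-cong (+-identityʳ a) N)) (q^-·-q^ a a N)) ⟩
    ((q^ 0) N xor (q^ a) N) xor ((q^ a) N xor (q^ (a + a)) N) ≡⟨ xor-cancel-middle ((q^ 0) N) ((q^ a) N) _ ⟩
    (one+q^ (a + a)) N                             ∎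
    where open ≡-Reasoning

  one+q^-⁴ : ∀ a → (one+q^ a) ⁴ ≈ one+q^ (4 * a)
  one+q^-⁴ a = begin
    (one+q^ a) ⁴                     ≈⟨ ⁴≈²² (one+q^ a) ⟩
    ((one+q^ a) ²) ²                 ≈⟨ ·-cong (one+q^-² a) (one+q^-² a) ⟩
    (one+q^ (a + a)) ²               ≈⟨ one+q^-² (a + a) ⟩
    one+q^ (a + a + (a + a))         ≈⟨ one+q^-cong (four a) ⟩
    one+q^ (4 * a)                   ∎
    where
    open ≈-Reasoning
    four : ∀ a → a + a + (a + a) ≡ 4 * a
    four = solve-∀

  -- the geometric series Σ_j q^(a j) = 1/(1 - q^a)
  geom₂ : ℕ → Series₂
  geom₂ a N = does (a ∣? N)

  -- (1 + q^a) Σ_j q^(a j) = 1 for a ≥ 1: the coefficient of q^N is [a ∣ N] + [a ∣ N - a] for N ≥ a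
  geom₂-inverse : ∀ a → one+q^ (suc a) · geom₂ (suc a) ≈ q^ 0
  geom₂-inverse a N = begin
    (one+q^ (suc a) · geom₂ (suc a)) N                        ≡⟨ ·-distribʳ (geom₂ (suc a)) (q^ 0) (q^ suc a) N ⟩
    (q^ 0 · geom₂ (suc a)) N xor (q^ suc a · geom₂ (suc a)) N
      ≡⟨ cong (_xor (q^ suc a · geom₂ (suc a)) N) (·-identityˡ (geom₂ (suc a)) N) ⟩
    geom₂ (suc a) N xor (q^ suc a · geom₂ (suc a)) N          ≡⟨ shifted (suc a ≤? N) ⟩
    (q^ 0) N                                                  ∎
    where
    open ≡-Reasoning
    G = geom₂ (suc a)
    periodic : suc a ≤ N → Dec (suc a ∣ N) → G N ≡ G (N ∸ suc a)
    periodic a≤N (yes a∣N) = trans (dec-true (suc a ∣? N) a∣N)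
      (sym (dec-true (suc a ∣? (N ∸ suc a)) (∣m+n∣m⇒∣n (subst (suc a ∣_) (sym (m+[n∸m]≡n a≤N)) a∣N) ∣-refl)))
    periodic a≤N (no a∤N) = trans (dec-false (suc a ∣? N) a∤N)
      (sym (dec-false (suc a ∣? (N ∸ suc a)) (λ a∣N-a → a∤N (∣m∸n∣n⇒∣m (suc a) a≤N a∣N-a ∣-refl))))
    below : ∀ N → N < suc a → G N ≡ (q^ 0) N
    below zero    _   = trans (dec-true (suc a ∣? 0) (suc a ∣0)) (sym (q^-≡ 0))
    below (suc n) n<a = trans (dec-false (suc a ∣? suc n) (λ a∣ → <⇒≱ n<a (∣⇒≤ a∣))) (sym (q^-≢ 0 (suc n) (λ ())))
    shifted : Dec (suc a ≤ N) → G N xor (q^ suc a · G) N ≡ (q^ 0) N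
    shifted (yes a≤N) = begin
      G N xor (q^ suc a · G) N ≡⟨ cong (G N xor_) (q^-·-≥ (suc a) G N a≤N) ⟩
      G N xor G (N ∸ suc a)    ≡⟨ cong (G N xor_) (periodic a≤N (suc a ∣? N)) ⟨
      G N xor G N              ≡⟨ xor-same (G N) ⟩
      false                    ≡⟨ q^-≢ 0 N (λ N≡0 → <⇒≢ (<-≤-trans (s≤s z≤n) a≤N) (sym N≡0)) ⟨
      (q^ 0) N                 ∎
    shifted (no a≰N) = begin
      G N xor (q^ suc a · G) N ≡⟨ cong (G N xor_) (q^-·-< (suc a) G N (≰⇒> a≰N)) ⟩
      G N xor false            ≡⟨ xor-identityʳ (G N) ⟩
      G N                      ≡⟨ below N (≰⇒> a≰N) ⟩
      (q^ 0) N                 ∎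

  -- (1 + q^a)⁴ (1 + q^b)⁻⁴ (1 + q^(4b)) = 1 + q^(4a) for b ≥ 1: the mod-2 shape of a factor
  -- (1-q^a)⁴/(1-q^b)⁴ of the eta quotient
  factor-identity : ∀ a b → (one+q^ a) ⁴ · (geom₂ (suc b)) ⁴ · one+q^ (4 * suc b) ≈ one+q^ (4 * a)
  factor-identity a b = begin
    A · B ⁴ · one+q^ (4 * suc b)    ≈⟨ ·-congʳ (A · B ⁴) (one+q^-⁴ (suc b)) ⟨
    A · B ⁴ · (one+q^ suc b) ⁴      ≈⟨ ·-assoc A (B ⁴) ((one+q^ suc b) ⁴) ⟩
    A · (B ⁴ · (one+q^ suc b) ⁴)    ≈⟨ ·-congʳ A (⁴-hom B (one+q^ suc b)) ⟨
    A · (B · one+q^ suc b) ⁴        ≈⟨ ·-congʳ A (⁴-cong (≈-trans (·-comm B (one+q^ suc b)) (geom₂-inverse b))) ⟩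
    A · (q^ 0) ⁴                    ≈⟨ ·-congʳ A ⁴-identity ⟩
    A · q^ 0                        ≈⟨ ·-identityʳ A ⟩
    A                               ≈⟨ one+q^-⁴ a ⟩
    one+q^ (4 * a)                  ∎
    where
    open ≈-Reasoning
    A = (one+q^ a) ⁴
    B = geom₂ (suc b)

-- Euler's pentagonal theorem over GF(2), in Shanks' finite form.
module Pentagonal where
  open import Data.Nat using (ℕ; zero; suc; _+_; _*_; _∸_; _≤_)
  open import Data.Nat.Properties using (≤-pred; +-identityʳ; +-suc; +-∸-assoc; m+[n∸m]≡n; n∸n≡0; *-zeroʳ)
  open import Data.Nat.Tactic.RingSolver using (solve-∀)
  open import Data.Bool using (_xor_)
  open import Data.Bool.Properties using (xor-comm; xor-same)
  open import Relation.Binary.PropositionalEquality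
  open XorSums
  open Series₂
  open Frobenius

  triangle : ℕ → ℕ
  triangle zero    = 0
  triangle (suc k) = triangle k + suc k

  -- the pentagonal numbers k(3k-1)/2 and k(3k+1)/2
  pentMinus : ℕ → ℕ
  pentMinus zero    = 0
  pentMinus (suc k) = suc k * suc k + triangle k

  pentPlus : ℕ → ℕ
  pentPlus k = k * k + triangle k

  prodFrom : ℕ → ℕ → ℕ → Series₂
  prodFrom c a zero    = q^ 0
  prodFrom c a (suc m) = prodFrom c a m · one+q^ (c * (a + m))

  euler : ℕ → ℕ → Series₂
  euler c n = prodFrom c 1 n

  tailProd : ℕ → ℕ → ℕ → Series₂
  tailProd c k n = prodFrom c (suc k) (n ∸ k)

  shanksTerm : ℕ → ℕ → ℕ → Series₂
  shanksTerm c n k = tailProd c k n · q^ (c * (k * n + triangle k))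

  shanksSum : ℕ → ℕ → Series₂
  shanksSum c n N = xorSum (suc n) (λ k → shanksTerm c n k N)

  pent : ℕ → ℕ → Series₂
  pent c zero    = q^ 0
  pent c (suc n) = pent c n ⊕ q^ (c * pentMinus (suc n)) ⊕ q^ (c * pentPlus (suc n))

  prodFrom-extend : ∀ c a m → prodFrom c (suc a) m · one+q^ (c * a) ≈ prodFrom c a (suc m)
  prodFrom-extend c a zero    =
    ≈-trans (·-identityˡ (one+q^ (c * a)))
            (≈-trans (one+q^-cong (cong (c *_) (sym (+-identityʳ a)))) (≈-sym (·-identityˡ (one+q^ (c * (a + 0))))))
  prodFrom-extend c a (suc m) = begin
    prodFrom c (suc a) m · one+q^ (c * (suc a + m)) · one+q^ (c * a)
      ≈⟨ ·-swapʳ (prodFrom c (suc a) m) (one+q^ (c * (suc a + m))) (one+q^ (c * a)) ⟩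
    prodFrom c (suc a) m · one+q^ (c * a) · one+q^ (c * (suc a + m))
      ≈⟨ ·-cong (prodFrom-extend c a m) (one+q^-cong (cong (c *_) (sym (+-suc a m)))) ⟩
    prodFrom c a (suc m) · one+q^ (c * (a + suc m)) ∎
    where open ≈-Reasoning

  tailProd-empty : ∀ c n → tailProd c n n ≈ q^ 0
  tailProd-empty c n rewrite n∸n≡0 n = ≈-refl

  tailProd-top : ∀ c n k → k ≤ n → tailProd c k (suc n) ≈ tailProd c k n · one+q^ (c * suc n)
  tailProd-top c n k k≤n rewrite +-∸-assoc 1 k≤n =
    ·-congʳ (tailProd c k n) (one+q^-cong (cong (c *_) (cong suc (m+[n∸m]≡n k≤n))))

  tailProd-bottom : ∀ c n k → suc k ≤ n → tailProd c (suc k) n · one+q^ (c * suc k) ≈ tailProd c k n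
  tailProd-bottom c n k k<n rewrite +-∸-assoc 1 k<n = prodFrom-extend c (suc k) (n ∸ suc k)

  module ShanksStep (c n′ : ℕ) where
    n = suc n′

    exponent : ℕ → ℕ
    exponent k = c * (k * n + triangle k)

    -- splitting the new top factor (1 + q^(cn)) off each term
    lower upper shifted : ℕ → Series₂
    lower   k = tailProd c k n′ · q^ (exponent k)
    upper   k = tailProd c k n′ · q^ (c * n + exponent k)
    shifted k = tailProd c k n′ · q^ (c * (suc k * n′ + triangle (suc k)))

    term-split : ∀ k → k ≤ n′ → shanksTerm c n k ≈ lower k ⊕ upper k
    term-split k k≤n′ = begin
      tailProd c k n · q^ (exponent k)                         ≈⟨ ·-congˡ (q^ exponent k) (tailProd-top c n′ k k≤n′) ⟩
      tailProd c k n′ · one+q^ (c * n) · q^ (exponent k)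
        ≈⟨ ·-assoc (tailProd c k n′) (one+q^ (c * n)) (q^ exponent k) ⟩
      tailProd c k n′ · (one+q^ (c * n) · q^ (exponent k))
        ≈⟨ ·-congʳ (tailProd c k n′) (one+q^-·-q^ (c * n) (exponent k)) ⟩
      tailProd c k n′ · (q^ exponent k ⊕ q^ (c * n + exponent k))
        ≈⟨ ·-distribˡ (tailProd c k n′) (q^ exponent k) (q^ (c * n + exponent k)) ⟩
      lower k ⊕ upper k                                        ∎
      where open ≈-Reasoning

    upper≈shifted : ∀ k → upper k ≈ shifted k
    upper≈shifted k = ·-congʳ (tailProd c k n′) (q^-cong (arith c k n′ (triangle k)))
      where
      arith : ∀ c j n′ t → c * suc n′ + c * (j * suc n′ + t) ≡ c * (suc j * n′ + (t + suc j))
      arith = solve-∀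

    -- lower (k+1) + T_{n′}(k+1) telescopes to shifted k
    lower-telescope : ∀ k → suc k ≤ n′ → lower (suc k) ⊕ shanksTerm c n′ (suc k) ≈ shifted k
    lower-telescope k k<n′ = begin
      R · q^ exponent (suc k) ⊕ R · q^ X                     ≈⟨ ·-distribˡ R (q^ exponent (suc k)) (q^ X) ⟨
      R · (q^ exponent (suc k) ⊕ q^ X)                        ≈⟨ ·-congʳ R reorder ⟩
      R · (q^ X ⊕ q^ (c * suc k + X))                         ≈⟨ ·-congʳ R (one+q^-·-q^ (c * suc k) X) ⟨
      R · (one+q^ (c * suc k) · q^ X)                         ≈⟨ ·-assoc R (one+q^ (c * suc k)) (q^ X) ⟨
      R · one+q^ (c * suc k) · q^ X                           ≈⟨ ·-congˡ (q^ X) (tailProd-bottom c n′ k k<n′) ⟩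
      shifted k                                               ∎
      where
      open ≈-Reasoning
      R = tailProd c (suc k) n′
      X = c * (suc k * n′ + triangle (suc k))
      arith : ∀ c k n′ t → c * (k * suc n′ + t) ≡ c * k + c * (k * n′ + t)
      arith = solve-∀
      reorder : q^ exponent (suc k) ⊕ q^ X ≈ q^ X ⊕ q^ (c * suc k + X)
      reorder N = trans (xor-comm ((q^ exponent (suc k)) N) ((q^ X) N)) (cong ((q^ X) N xor_) (q^-cong (arith c (suc k) n′ (triangle (suc k))) N))

    shifted-top : shifted n′ ≈ q^ (c * pentMinus n)
    shifted-top = ≈-trans (·-congˡ (q^ X) (tailProd-empty c n′))
                          (≈-trans (·-identityˡ (q^ X)) (q^-cong (arith c n′ (triangle n′))))
      where
      X = c * (suc n′ * n′ + triangle (suc n′))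
      arith : ∀ c n′ t → c * (suc n′ * n′ + (t + suc n′)) ≡ c * (suc n′ * suc n′ + t)
      arith = solve-∀

    top-term : shanksTerm c n n ≈ q^ (c * pentPlus n)
    top-term = ≈-trans (·-congˡ (q^ exponent n) (tailProd-empty c n)) (·-identityˡ (q^ exponent n))

    -- Σ_{k≤n′} lower k = Σ_{k<n′} shifted k + S_{n′}: add S_{n′} twice; the k = 0 terms of the two sums
    -- coincide, the others telescope
    sum-lower : ∀ N → xorSum n (λ k → lower k N) ≡ xorSum n′ (λ k → shifted k N) xor shanksSum c n′ N
    sum-lower N = begin
      Lo                                                      ≡⟨ xor-cancelʳ Lo S′ ⟨
      (Lo xor S′) xor S′
        ≡⟨ cong (_xor S′) (xorSum-xor n (λ k → lower k N) (λ k → shanksTerm c n′ k N)) ⟨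
      xorSum n (λ k → lower k N xor shanksTerm c n′ k N) xor S′
        ≡⟨ cong (_xor S′) (xorSum-front n′ (λ k → lower k N xor shanksTerm c n′ k N)) ⟩
      ((lower 0 N xor lower 0 N) xor xorSum n′ (λ k → lower (suc k) N xor shanksTerm c n′ (suc k) N)) xor S′
        ≡⟨ cong (λ b → (b xor Tel) xor S′) (xor-same (lower 0 N)) ⟩
      xorSum n′ (λ k → lower (suc k) N xor shanksTerm c n′ (suc k) N) xor S′
        ≡⟨ cong (_xor S′) (xorSum-cong n′ (λ k k<n′ → lower-telescope k k<n′ N)) ⟩
      xorSum n′ (λ k → shifted k N) xor S′                    ∎
      where
      open ≡-Reasoning
      Lo = xorSum n (λ k → lower k N)
      Tel = xorSum n′ (λ k → lower (suc k) N xor shanksTerm c n′ (suc k) N)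
      S′ = shanksSum c n′ N

    shanks-step : shanksSum c n ≈ shanksSum c n′ ⊕ q^ (c * pentMinus n) ⊕ q^ (c * pentPlus n)
    shanks-step N = begin
      xorSum n (λ k → shanksTerm c n k N) xor shanksTerm c n n N
        ≡⟨ cong₂ _xor_ (xorSum-cong n (λ k k<n → term-split k (≤-pred k<n) N)) (top-term N) ⟩
      xorSum n (λ k → lower k N xor upper k N) xor Top
        ≡⟨ cong (_xor Top) (xorSum-xor n (λ k → lower k N) (λ k → upper k N)) ⟩
      (xorSum n (λ k → lower k N) xor xorSum n (λ k → upper k N)) xor Top
        ≡⟨ cong (λ b → (b xor xorSum n (λ k → upper k N)) xor Top) (sum-lower N) ⟩
      ((Sh xor shanksSum c n′ N) xor xorSum n (λ k → upper k N)) xor Top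
        ≡⟨ cong (λ b → ((Sh xor shanksSum c n′ N) xor b) xor Top) (xorSum-cong n (λ k _ → upper≈shifted k N)) ⟩
      ((Sh xor shanksSum c n′ N) xor (Sh xor shifted n′ N)) xor Top
        ≡⟨ cong (_xor Top) (xor-cancelˡ Sh (shanksSum c n′ N) (shifted n′ N)) ⟩
      (shanksSum c n′ N xor shifted n′ N) xor Top
        ≡⟨ cong (λ b → (shanksSum c n′ N xor b) xor Top) (shifted-top N) ⟩
      (shanksSum c n′ ⊕ q^ (c * pentMinus n) ⊕ q^ (c * pentPlus n)) N ∎
      where
      open ≡-Reasoning
      Sh  = xorSum n′ (λ k → shifted k N)
      Top = (q^ (c * pentPlus n)) N

  shanks : ∀ c n → shanksSum c n ≈ pent c n
  shanks c zero    N = trans (·-identityˡ (q^ (c * 0)) N) (q^-cong (*-zeroʳ c) N)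
  shanks c (suc n) = ≈-trans (ShanksStep.shanks-step c n) (⊕-cong (⊕-cong (shanks c n) ≈-refl) ≈-refl)

module PentagonalCoefficients where
  open import Data.Nat using (ℕ; zero; suc; _+_; _*_; _<_; _≤_; s≤s; z≤n; NonZero)
  open import Data.Nat.Properties
  open import Data.Bool using (true; false; _xor_)
  open import Data.Bool.Properties using (xor-identityʳ; xor-assoc)
  open import Data.Nat.Tactic.RingSolver using (solve-∀)
  open import Data.Sum using (inj₁; inj₂)
  open import Relation.Binary.PropositionalEquality
  open XorSums
  open Series₂
  open Frobenius
  open Pentagonal

  shanksExponent-large : ∀ c .{{_ : NonZero c}} n k → n < c * (suc k * n + triangle (suc k))
  shanksExponent-large c n k = begin-strict
    n                                   ≤⟨ m≤m+n n (k * n) ⟩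
    suc k * n                           <⟨ m<m+n (suc k * n) (≤-trans (s≤s z≤n) (m≤n+m (suc k) (triangle k))) ⟩
    suc k * n + triangle (suc k)        ≤⟨ m≤n*m (suc k * n + triangle (suc k)) c ⟩
    c * (suc k * n + triangle (suc k))  ∎
    where open ≤-Reasoning

  -- Euler's product agrees with Shanks' sum in degrees ≤ n (it is the term k = 0)
  euler≈shanks-upTo : ∀ c .{{_ : NonZero c}} n N → N ≤ n → euler c n N ≡ shanksSum c n N
  euler≈shanks-upTo c n N N≤n = sym (begin
    shanksSum c n N                                                 ≡⟨ xorSum-front n (λ k → shanksTerm c n k N) ⟩
    shanksTerm c n 0 N xor xorSum n (λ k → shanksTerm c n (suc k) N) ≡⟨ cong₂ _xor_ first (xorSum-zero n (λ k _ → later k)) ⟩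
    euler c n N xor false                                           ≡⟨ xor-identityʳ _ ⟩
    euler c n N                                                     ∎)
    where
    open ≡-Reasoning
    first : shanksTerm c n 0 N ≡ euler c n N
    first = trans (·-congʳ (euler c n) (q^-cong (*-zeroʳ c)) N) (·-identityʳ (euler c n) N)
    later : ∀ k → shanksTerm c n (suc k) N ≡ false
    later k = ·-q^-< _ (tailProd c (suc k) n) N (≤-<-trans N≤n (shanksExponent-large c n k))

  euler≈pent-upTo : ∀ c .{{_ : NonZero c}} n N → N ≤ n → euler c n N ≡ pent c n N
  euler≈pent-upTo c n N N≤n = trans (euler≈shanks-upTo c n N N≤n) (shanks c n N)

  triangle-closed : ∀ k → 2 * triangle k ≡ k * suc k
  triangle-closed zero    = refl
  triangle-closed (suc k) = begin
    2 * (triangle k + suc k)        ≡⟨ *-distribˡ-+ 2 (triangle k) (suc k) ⟩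
    2 * triangle k + 2 * suc k      ≡⟨ cong (_+ 2 * suc k) (triangle-closed k) ⟩
    k * suc k + 2 * suc k           ≡⟨ arith k ⟩
    suc k * suc (suc k)             ∎
    where
    open ≡-Reasoning
    arith : ∀ k → k * suc k + 2 * suc k ≡ suc k * suc (suc k)
    arith = solve-∀

  pentMinus-closed : ∀ a k → 2 * a * suc k * (2 + 3 * k) ≡ 4 * a * pentMinus (suc k)
  pentMinus-closed a k = begin
    2 * a * suc k * (2 + 3 * k)                        ≡⟨ expand a k ⟩
    4 * a * (suc k * suc k) + 2 * a * (k * suc k)
      ≡⟨ cong (λ z → 4 * a * (suc k * suc k) + 2 * a * z) (triangle-closed k) ⟨
    4 * a * (suc k * suc k) + 2 * a * (2 * triangle k) ≡⟨ collect a k (triangle k) ⟩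
    4 * a * pentMinus (suc k)                          ∎
    where
    open ≡-Reasoning
    expand : ∀ a k → 2 * a * suc k * (2 + 3 * k) ≡ 4 * a * (suc k * suc k) + 2 * a * (k * suc k)
    expand = solve-∀
    collect : ∀ a k t → 4 * a * (suc k * suc k) + 2 * a * (2 * t) ≡ 4 * a * (suc k * suc k + t)
    collect = solve-∀

  pentPlus-closed : ∀ a k → 2 * a * k * (3 * k + 1) ≡ 4 * a * pentPlus k
  pentPlus-closed a k = begin
    2 * a * k * (3 * k + 1)                     ≡⟨ expand a k ⟩
    4 * a * (k * k) + 2 * a * (k * suc k)       ≡⟨ cong (λ z → 4 * a * (k * k) + 2 * a * z) (triangle-closed k) ⟨
    4 * a * (k * k) + 2 * a * (2 * triangle k)  ≡⟨ collect a k (triangle k) ⟩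
    4 * a * pentPlus k                          ∎
    where
    open ≡-Reasoning
    expand : ∀ a k → 2 * a * k * (3 * k + 1) ≡ 4 * a * (k * k) + 2 * a * (k * suc k)
    expand = solve-∀
    collect : ∀ a k t → 4 * a * (k * k) + 2 * a * (2 * t) ≡ 4 * a * (k * k + t)
    collect = solve-∀

  pentPlus≡pentMinus+ : ∀ k → pentPlus k ≡ pentMinus k + k
  pentPlus≡pentMinus+ zero    = refl
  pentPlus≡pentMinus+ (suc k) = sym (+-assoc (suc k * suc k) (triangle k) (suc k))

  pentMinus≤pentPlus : ∀ k → pentMinus k ≤ pentPlus k
  pentMinus≤pentPlus k = subst (pentMinus k ≤_) (sym (pentPlus≡pentMinus+ k)) (m≤m+n (pentMinus k) k)

  pentMinus<pentPlus : ∀ k → pentMinus (suc k) < pentPlus (suc k)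
  pentMinus<pentPlus k = subst (pentMinus (suc k) <_) (sym (pentPlus≡pentMinus+ (suc k))) (m<m+n (pentMinus (suc k)) (s≤s z≤n))

  pentMinus-large : ∀ l → l ≤ pentMinus l
  pentMinus-large zero    = z≤n
  pentMinus-large (suc k) = ≤-trans (m≤m*n (suc k) (suc k)) (m≤m+n (suc k * suc k) (triangle k))

  pentPlus-large : ∀ l → l ≤ pentPlus l
  pentPlus-large l = ≤-trans (pentMinus-large l) (pentMinus≤pentPlus l)

  pentPlus<pentMinus : ∀ n → pentPlus n < pentMinus (suc n)
  pentPlus<pentMinus n = subst (pentPlus n <_) (sym (arith n (triangle n))) (m<m+n (pentPlus n) (s≤s z≤n))
    where
    arith : ∀ n t → suc n * suc n + t ≡ n * n + t + suc (n + n)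
    arith = solve-∀

  pentPlus<pentPlus : ∀ n → pentPlus n < pentPlus (suc n)
  pentPlus<pentPlus n = <-≤-trans (pentPlus<pentMinus n) (pentMinus≤pentPlus (suc n))

  pentPlus-mono : ∀ {m n} → m ≤ n → pentPlus m ≤ pentPlus n
  pentPlus-mono {m} {n}     m≤n with m≤n⇒m<n∨m≡n m≤n
  ... | inj₂ refl = ≤-refl
  pentPlus-mono {m} {suc n} _ | inj₁ m<1+n = ≤-trans (pentPlus-mono (≤-pred m<1+n)) (<⇒≤ (pentPlus<pentPlus n))

  pentMinus≤pentPlus-mono : ∀ {l n} → l ≤ n → pentMinus l ≤ pentPlus n
  pentMinus≤pentPlus-mono {l} l≤n = ≤-trans (pentMinus≤pentPlus l) (pentPlus-mono l≤n)

  module _ (c : ℕ) .{{_ : NonZero c}} where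
    c*-< : ∀ {a b} → a < b → c * a < c * b
    c*-< = *-monoʳ-< c

    c*-≢ : ∀ {a b} → a < b → c * a ≢ c * b
    c*-≢ a<b = <⇒≢ (c*-< a<b)

    pent-beyond : ∀ n j → c * pentPlus n < j → pent c n j ≡ false
    pent-beyond zero    j 0<j = q^-≢ 0 j (λ j≡0 → <⇒≢ 0<j (sym (trans j≡0 (sym (*-zeroʳ c)))))
    pent-beyond (suc n) j top<j
      rewrite pent-beyond n j (<-trans (c*-< (pentPlus<pentPlus n)) top<j)
            | q^-≢ (c * pentMinus (suc n)) j (λ e → <⇒≢ (<-trans (c*-< (pentMinus<pentPlus n)) top<j) (sym e))
            | q^-≢ (c * pentPlus (suc n)) j (λ e → <⇒≢ top<j (sym e)) = refl

    pent-below : ∀ n j → j < c * pentMinus (suc n) → pent c (suc n) j ≡ pent c n j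
    pent-below n j j<A
      rewrite q^-≢ (c * pentMinus (suc n)) j (<⇒≢ j<A)
            | q^-≢ (c * pentPlus (suc n)) j (<⇒≢ (<-trans j<A (c*-< (pentMinus<pentPlus n)))) =
      trans (xor-identityʳ _) (xor-identityʳ _)

    pent-at-pentMinus : ∀ n l → l ≤ n → pent c n (c * pentMinus l) ≡ true
    pent-at-pentMinus zero    .zero z≤n = trans (cong (pent c 0) (*-zeroʳ c)) (q^-≡ 0)
    pent-at-pentMinus (suc n) l l≤1+n with m≤n⇒m<n∨m≡n l≤1+n
    ... | inj₁ l<1+n =
      trans (pent-below n (c * pentMinus l) (c*-< (≤-<-trans (pentMinus≤pentPlus-mono (≤-pred l<1+n)) (pentPlus<pentMinus n))))
            (pent-at-pentMinus n l (≤-pred l<1+n))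
    ... | inj₂ refl
      rewrite pent-beyond n (c * pentMinus (suc n)) (c*-< (pentPlus<pentMinus n))
            | q^-≡ (c * pentMinus (suc n))
            | q^-≢ (c * pentPlus (suc n)) (c * pentMinus (suc n)) (c*-≢ (pentMinus<pentPlus n)) = refl

    pent-at-pentPlus : ∀ n l → 1 ≤ l → l ≤ n → pent c n (c * pentPlus l) ≡ true
    pent-at-pentPlus zero    (suc l) 1≤l ()
    pent-at-pentPlus (suc n) l 1≤l l≤1+n with m≤n⇒m<n∨m≡n l≤1+n
    ... | inj₁ l<1+n =
      trans (pent-below n (c * pentPlus l) (c*-< (≤-<-trans (pentPlus-mono (≤-pred l<1+n)) (pentPlus<pentMinus n))))
            (pent-at-pentPlus n l 1≤l (≤-pred l<1+n))
    ... | inj₂ refl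
      rewrite pent-beyond n (c * pentPlus (suc n)) (c*-< (pentPlus<pentPlus n))
            | q^-≢ (c * pentMinus (suc n)) (c * pentPlus (suc n)) (λ e → c*-≢ (pentMinus<pentPlus n) (sym e))
            | q^-≡ (c * pentPlus (suc n)) = refl

  pent-elsewhere : ∀ c n j → (∀ l → j ≢ c * pentMinus l) → (∀ l → j ≢ c * pentPlus l) → pent c n j ≡ false
  pent-elsewhere c zero    j ≢A ≢B = q^-≢ 0 j (λ j≡0 → ≢A 0 (trans j≡0 (sym (*-zeroʳ c))))
  pent-elsewhere c (suc n) j ≢A ≢B
    rewrite pent-elsewhere c n j ≢A ≢B | q^-≢ _ j (≢A (suc n)) | q^-≢ _ j (≢B (suc n)) = refl

  pent≡twoSums : ∀ c n N →
    pent c n N ≡ xorSum (suc n) (λ k → (q^ (c * pentMinus k)) N) xor xorSum n (λ k → (q^ (c * pentPlus (suc k))) N)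
  pent≡twoSums c zero    N = trans (q^-cong (sym (*-zeroʳ c)) N) (sym (xor-identityʳ _))
  pent≡twoSums c (suc n) N rewrite pent≡twoSums c n N =
    trans (xor-assoc (A xor B) a b) (xor-interchange A B a b)
    where
    A = xorSum (suc n) (λ k → (q^ (c * pentMinus k)) N)
    B = xorSum n (λ k → (q^ (c * pentPlus (suc k))) N)
    a = (q^ (c * pentMinus (suc n))) N
    b = (q^ (c * pentPlus (suc n))) N

module Parity where
  open import Defs using (sumTo)
  open import Data.Nat using (ℕ; zero; suc; _+_; _*_)
  open import Data.Nat.Divisibility as ℕ∣ using (divides; ∣m∣n⇒∣m+n; ∣-refl; _∣0)
  import Data.Integer as ℤ
  import Data.Integer.Properties as ℤP
  open ℤ using (ℤ; +_; -[1+_]; ∣_∣)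
  open import Data.Bool using (Bool; true; false; not; _∧_; _xor_; if_then_else_)
  open import Data.Bool.Properties
    using (xor-comm; xor-identityʳ; ∧-zeroʳ; not-involutive; not-distribˡ-xor; xor-annihilates-not)
  open import Relation.Binary.PropositionalEquality
  open XorSums

  odd : ℕ → Bool
  odd zero    = false
  odd (suc n) = not (odd n)

  odd-+ : ∀ m n → odd (m + n) ≡ odd m xor odd n
  odd-+ zero    n = refl
  odd-+ (suc m) n rewrite odd-+ m n = not-distribˡ-xor (odd m) (odd n)

  odd-* : ∀ m n → odd (m * n) ≡ odd m ∧ odd n
  odd-* zero    n = refl
  odd-* (suc m) n rewrite odd-+ n (m * n) | odd-* m n = lemma (odd m) (odd n)
    where
    lemma : ∀ a b → b xor (a ∧ b) ≡ not a ∧ b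
    lemma false b = xor-identityʳ b
    lemma true  false = refl
    lemma true  true  = refl

  ¬odd⇒2∣ : ∀ n → odd n ≡ false → 2 ℕ∣.∣ n
  ¬odd⇒2∣ zero          _ = 2 ∣0
  ¬odd⇒2∣ (suc zero)    ()
  ¬odd⇒2∣ (suc (suc n)) e rewrite not-involutive (odd n) = ∣m∣n⇒∣m+n {2} {2} {n} ∣-refl (¬odd⇒2∣ n e)

  2∣⇒¬odd : ∀ n → 2 ℕ∣.∣ n → odd n ≡ false
  2∣⇒¬odd n (divides q refl) rewrite odd-* q 2 = ∧-zeroʳ (odd q)

  parity : ℤ → Bool
  parity x = odd ∣ x ∣

  parity-⊖ : ∀ m n → parity (m ℤ.⊖ n) ≡ odd m xor odd n
  parity-⊖ zero    zero    = refl
  parity-⊖ zero    (suc n) = refl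
  parity-⊖ (suc m) zero    = sym (xor-identityʳ _)
  parity-⊖ (suc m) (suc n) rewrite ℤP.[1+m]⊖[1+n]≡m⊖n m n | parity-⊖ m n = sym (xor-annihilates-not (odd m) (odd n))

  parity-+ : ∀ a b → parity (a ℤ.+ b) ≡ parity a xor parity b
  parity-+ -[1+ m ] -[1+ n ] rewrite not-involutive (odd (m + n)) | odd-+ m n = sym (xor-annihilates-not (odd m) (odd n))
  parity-+ -[1+ m ] (+ n)    rewrite parity-⊖ n (suc m) = xor-comm (odd n) (not (odd m))
  parity-+ (+ m)    -[1+ n ] = parity-⊖ m (suc n)
  parity-+ (+ m)    (+ n)    = odd-+ m n

  parity-- : ∀ a b → parity (a ℤ.- b) ≡ parity a xor parity b
  parity-- a b rewrite parity-+ a (ℤ.- b) | ℤP.∣-i∣≡∣i∣ b = refl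

  parity-* : ∀ a b → parity (a ℤ.* b) ≡ parity a ∧ parity b
  parity-* a b rewrite ℤP.abs-* a b = odd-* ∣ a ∣ ∣ b ∣

  parity-if : ∀ b → parity (if b then + 1 else + 0) ≡ b
  parity-if false = refl
  parity-if true  = refl

  parity-sumTo : ∀ n f → parity (sumTo n f) ≡ xorSum n (λ i → parity (f i))
  parity-sumTo zero    f = refl
  parity-sumTo (suc n) f rewrite parity-+ (sumTo n f) (f n) | parity-sumTo n f = refl

module Reduction where
  open import Defs
  open import Data.Nat using (ℕ; zero; suc; _+_; _*_; _∸_; _<_; _≤_; _≤?_; s≤s; z≤n; NonZero)
  open import Data.Nat.Properties
  open import Data.Nat.Tactic.RingSolver using (solve-∀)
  import Data.Integer as ℤ
  import Data.Integer.Properties as ℤP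
  open ℤ using (ℤ; +_; -[1+_]; ∣_∣)
  import Data.Integer.Divisibility as ℤ∣
  open import Data.Bool using (true; false; _xor_)
  open import Data.Bool.Properties using (xor-identityʳ)
  open import Relation.Binary.PropositionalEquality
  open import Relation.Nullary using (yes; no; ¬_)
  open import Data.Sum using (inj₁; inj₂)
  open XorSums
  open Series₂
  open Frobenius
  open Pentagonal
  open PentagonalCoefficients
  open Parity

  ⟦_⟧ : Series → Series₂
  ⟦ f ⟧ N = parity (f N)

  ⟦conv⟧ : ∀ f g → ⟦ conv f g ⟧ ≈ ⟦ f ⟧ · ⟦ g ⟧
  ⟦conv⟧ f g N = trans (parity-sumTo (suc N) _) (xorSum-cong (suc N) (λ i _ → parity-* (f i) (g (N ∸ i))))

  ⟦pow4⟧ : ∀ f → ⟦ pow4 f ⟧ ≈ ⟦ f ⟧ ⁴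
  ⟦pow4⟧ f = ≈-trans (⟦conv⟧ f (conv f (conv f f)))
                     (·-congʳ ⟦ f ⟧ (≈-trans (⟦conv⟧ f (conv f f)) (·-congʳ ⟦ f ⟧ (⟦conv⟧ f f))))

  ⟦unitS⟧ : ⟦ unitS ⟧ ≈ q^ 0
  ⟦unitS⟧ N = parity-if _

  ⟦oneMinus⟧ : ∀ m → ⟦ oneMinus m ⟧ ≈ one+q^ m
  ⟦oneMinus⟧ m N = trans (parity-- (unitS N) _) (cong₂ _xor_ (⟦unitS⟧ N) (parity-if _))

  ⟦geom⟧ : ∀ m → ⟦ geom m ⟧ ≈ geom₂ m
  ⟦geom⟧ m N = parity-if _

  ⟦factor⟧ : ∀ k → ⟦ factor k ⟧ ≈ (one+q^ suc k) ⁴ · (geom₂ (7 * suc k)) ⁴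
  ⟦factor⟧ k = ≈-trans (⟦conv⟧ (pow4 (oneMinus (suc k))) (pow4 (geom (7 * suc k))))
                       (·-cong (≈-trans (⟦pow4⟧ (oneMinus (suc k))) (⁴-cong (⟦oneMinus⟧ (suc k))))
                               (≈-trans (⟦pow4⟧ (geom (7 * suc k))) (⁴-cong (⟦geom⟧ (7 * suc k)))))

  factor-mod2 : ∀ k → ⟦ factor k ⟧ · one+q^ (28 * suc k) ≈ one+q^ (4 * suc k)
  factor-mod2 k = begin
    ⟦ factor k ⟧ · one+q^ (28 * suc k)
      ≈⟨ ·-cong (⟦factor⟧ k) (one+q^-cong (*-assoc 4 7 (suc k))) ⟩
    (one+q^ suc k) ⁴ · (geom₂ (7 * suc k)) ⁴ · one+q^ (4 * (7 * suc k))
      ≈⟨ factor-identity (suc k) (k + 6 * suc k) ⟩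
    one+q^ (4 * suc k) ∎
    where open ≈-Reasoning

  etaProd : ℕ → Series₂
  etaProd K = ⟦ prodTo K ⟧

  etaProd-·-euler : ∀ K → etaProd K · euler 28 K ≈ euler 4 K
  etaProd-·-euler zero    = ≈-trans (·-identityʳ (etaProd 0)) ⟦unitS⟧
  etaProd-·-euler (suc K) = begin
    etaProd (suc K) · euler 28 (suc K)
      ≈⟨ ·-congˡ (euler 28 (suc K)) (⟦conv⟧ (prodTo K) (factor K)) ⟩
    etaProd K · ⟦ factor K ⟧ · (euler 28 K · one+q^ (28 * suc K))
      ≈⟨ ·-interchange (etaProd K) ⟦ factor K ⟧ (euler 28 K) (one+q^ (28 * suc K)) ⟩
    etaProd K · euler 28 K · (⟦ factor K ⟧ · one+q^ (28 * suc K)) ≈⟨ ·-cong (etaProd-·-euler K) (factor-mod2 K) ⟩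
    euler 4 K · one+q^ (4 * suc K)                              ∎
    where open ≈-Reasoning

  -- a factor is 1 + O(q^{K+1}): from factor-mod2, as 28(K+1) and 4(K+1) exceed K
  factor-low : ∀ K j → j ≤ K → ⟦ factor K ⟧ j ≡ (q^ 0) j
  factor-low K j j≤K = begin
    F j                                  ≡⟨ xor-identityʳ (F j) ⟨
    F j xor false                        ≡⟨ cong₂ _xor_ (·-identityʳ F j) (·-q^-< (28 * suc K) F j (beyond 28)) ⟨
    (F · q^ 0) j xor (F · q^ (28 * suc K)) j ≡⟨ ·-distribˡ F (q^ 0) (q^ (28 * suc K)) j ⟨
    (F · one+q^ (28 * suc K)) j          ≡⟨ factor-mod2 K j ⟩
    (q^ 0) j xor (q^ (4 * suc K)) j      ≡⟨ cong ((q^ 0) j xor_) (q^-≢ (4 * suc K) j (<⇒≢ (beyond 4))) ⟩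
    (q^ 0) j xor false                   ≡⟨ xor-identityʳ _ ⟩
    (q^ 0) j                             ∎
    where
    open ≡-Reasoning
    F = ⟦ factor K ⟧
    beyond : ∀ c → .{{_ : NonZero c}} → j < c * suc K
    beyond c = <-≤-trans (s≤s j≤K) (m≤n*m (suc K) c)

  etaProd-step : ∀ K j → j ≤ K → etaProd (suc K) j ≡ etaProd K j
  etaProd-step K j j≤K = trans (⟦conv⟧ (prodTo K) (factor K) j)
    (trans (·-cong-upTo (etaProd K) j (λ i i≤j → factor-low K i (≤-trans i≤j j≤K))) (·-identityʳ (etaProd K) j))

  etaProd-stable : ∀ j K → j ≤ K → etaProd K j ≡ etaProd j j
  etaProd-stable j K j≤K with m≤n⇒m<n∨m≡n j≤K
  ... | inj₂ refl = refl
  etaProd-stable j (suc K) j≤1+K | inj₁ j<1+K =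
    trans (etaProd-step K j (≤-pred j<1+K)) (etaProd-stable j K (≤-pred j<1+K))

  -- a₇⁺(n) is the coefficient of q^{n+1} of the product (Defs truncates it exactly at m = n + 1)
  a7+-shifted : ∀ M → a7+ (+ M ℤ.- + 1) ≡ prodCoef M
  a7+-shifted zero    = refl
  a7+-shifted (suc M) = refl

  a7+-as-coefficient : ∀ N p → parity (a7+ (+ N ℤ.- + p ℤ.- + 1)) ≡ (etaProd N · q^ p) N
  a7+-as-coefficient N p with p ≤? N
  ... | yes p≤N = begin
    parity (a7+ (+ N ℤ.- + p ℤ.- + 1))  ≡⟨ cong (λ z → parity (a7+ (z ℤ.- + 1))) (trans (ℤP.m-n≡m⊖n N p) (ℤP.⊖-≥ p≤N)) ⟩
    parity (a7+ (+ (N ∸ p) ℤ.- + 1))    ≡⟨ cong parity (a7+-shifted (N ∸ p)) ⟩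
    etaProd (N ∸ p) (N ∸ p)             ≡⟨ etaProd-stable (N ∸ p) N (m∸n≤m N p) ⟨
    etaProd N (N ∸ p)                   ≡⟨ ·-q^-≥ p (etaProd N) N p≤N ⟨
    (etaProd N · q^ p) N                ∎
    where open ≡-Reasoning
  ... | no p≰N = trans (cong (λ z → parity (a7+ (z ℤ.- + 1))) (trans (ℤP.m-n≡m⊖n N p) (ℤP.⊖-< (≰⇒> p≰N))))
                       (trans (vanishes p (≰⇒> p≰N)) (sym (·-q^-< p (etaProd N) N (≰⇒> p≰N))))
    where
    vanishes : ∀ p → N < p → parity (a7+ (ℤ.- (+ (p ∸ N)) ℤ.- + 1)) ≡ false
    vanishes (suc p) N<1+p rewrite +-∸-assoc 1 (≤-pred N<1+p) = refl

  a7+-negative : ∀ N′ p → a7+ (-[1+ N′ ] ℤ.- + p ℤ.- + 1) ≡ + 0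
  a7+-negative N′ zero    = refl
  a7+-negative N′ (suc p) = refl

  cast-minus : ∀ b k → + b ℤ.* + suc k ℤ.* (+ 3 ℤ.* + suc k ℤ.- + 1) ≡ + (b * suc k * (2 + 3 * k))
  cast-minus b k = begin
    + b ℤ.* + suc k ℤ.* (+ 3 ℤ.* + suc k ℤ.- + 1)   ≡⟨ cong (λ z → + b ℤ.* + suc k ℤ.* (z ℤ.- + 1)) (ℤP.pos-* 3 (suc k)) ⟨
    + b ℤ.* + suc k ℤ.* (+ (3 * suc k) ℤ.- + 1)
      ≡⟨ cong (+ b ℤ.* + suc k ℤ.*_) (trans (ℤP.m-n≡m⊖n (3 * suc k) 1) (ℤP.⊖-≥ (s≤s z≤n))) ⟩
    + b ℤ.* + suc k ℤ.* + (3 * suc k ∸ 1)           ≡⟨ cong (λ z → + b ℤ.* + suc k ℤ.* + z) (cong (_∸ 1) (three k)) ⟩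
    + b ℤ.* + suc k ℤ.* + (2 + 3 * k)               ≡⟨ cong (ℤ._* + (2 + 3 * k)) (ℤP.pos-* b (suc k)) ⟨
    + (b * suc k) ℤ.* + (2 + 3 * k)                 ≡⟨ ℤP.pos-* (b * suc k) (2 + 3 * k) ⟨
    + (b * suc k * (2 + 3 * k))                     ∎
    where
    open ≡-Reasoning
    three : ∀ k → 3 * suc k ≡ suc (2 + 3 * k)
    three = solve-∀

  cast-plus : ∀ b k → + b ℤ.* + k ℤ.* (+ 3 ℤ.* + k ℤ.+ + 1) ≡ + (b * k * (3 * k + 1))
  cast-plus b k = begin
    + b ℤ.* + k ℤ.* (+ 3 ℤ.* + k ℤ.+ + 1)   ≡⟨ cong (λ z → + b ℤ.* + k ℤ.* (z ℤ.+ + 1)) (ℤP.pos-* 3 k) ⟨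
    + b ℤ.* + k ℤ.* (+ (3 * k) ℤ.+ + 1)     ≡⟨ cong (ℤ._* (+ (3 * k) ℤ.+ + 1)) (ℤP.pos-* b k) ⟨
    + (b * k) ℤ.* + (3 * k + 1)             ≡⟨ ℤP.pos-* (b * k) (3 * k + 1) ⟨
    + (b * k * (3 * k + 1))                 ∎
    where open ≡-Reasoning

  generalizedPentMinus : ∀ a l → + (2 * a) ℤ.* + l ℤ.* (+ 3 ℤ.* + l ℤ.- + 1) ≡ + (4 * a * pentMinus l)
  generalizedPentMinus a zero    = trans (cong (ℤ._* (+ 0 ℤ.- + 1)) (ℤP.*-zeroʳ (+ (2 * a)))) (cong +_ (sym (*-zeroʳ (4 * a))))
  generalizedPentMinus a (suc k) = trans (cast-minus (2 * a) k) (cong +_ (pentMinus-closed a k))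

  generalizedPentPlus : ∀ a l → + (2 * a) ℤ.* + l ℤ.* (+ 3 ℤ.* + l ℤ.+ + 1) ≡ + (4 * a * pentPlus l)
  generalizedPentPlus a l = trans (cast-plus (2 * a) l) (cong +_ (pentPlus-closed a l))

  lhsExponents : ℕ → Series₂
  lhsExponents N j = xorSum (suc N) (λ k → (q^ (28 * pentMinus k)) j) xor xorSum (suc N) (λ k → (q^ (28 * pentPlus (suc k))) j)

  lhsSum-as-coefficient : ∀ N → parity (lhsSum (+ N)) ≡ (etaProd N · lhsExponents N) N
  lhsSum-as-coefficient N = begin
    parity (lhsSum (+ N))
      ≡⟨ parity-+ (sumTo (suc N) minusTerm) (sumTo (suc N) plusTerm) ⟩
    parity (sumTo (suc N) minusTerm) xor parity (sumTo (suc N) plusTerm)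
      ≡⟨ cong₂ _xor_ (parity-sumTo (suc N) minusTerm) (parity-sumTo (suc N) plusTerm) ⟩
    xorSum (suc N) (λ k → parity (minusTerm k)) xor xorSum (suc N) (λ k → parity (plusTerm k))
      ≡⟨ cong₂ _xor_ (xorSum-cong (suc N) (λ k _ → minusCoefficient k)) (xorSum-cong (suc N) (λ k _ → plusCoefficient k)) ⟩
    xorSum (suc N) (λ k → (P · q^ (28 * pentMinus k)) N) xor xorSum (suc N) (λ k → (P · q^ (28 * pentPlus (suc k))) N)
      ≡⟨ cong₂ _xor_ (·-xorSum (suc N) P (λ k → q^ (28 * pentMinus k)) N) (·-xorSum (suc N) P (λ k → q^ (28 * pentPlus (suc k))) N) ⟩
    (P · minusExponents) N xor (P · plusExponents) N
      ≡⟨ ·-distribˡ P minusExponents plusExponents N ⟨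
    (P · lhsExponents N) N ∎
    where
    open ≡-Reasoning
    P = etaProd N
    minusTerm plusTerm : ℕ → ℤ
    minusTerm k = a7+ (+ N ℤ.- penM k ℤ.- + 1)
    plusTerm  k = a7+ (+ N ℤ.- penP (suc k) ℤ.- + 1)
    minusExponents plusExponents : Series₂
    minusExponents j = xorSum (suc N) (λ k → (q^ (28 * pentMinus k)) j)
    plusExponents  j = xorSum (suc N) (λ k → (q^ (28 * pentPlus (suc k))) j)
    minusCoefficient : ∀ k → parity (minusTerm k) ≡ (P · q^ (28 * pentMinus k)) N
    minusCoefficient k = trans (cong (λ z → parity (a7+ (+ N ℤ.- z ℤ.- + 1))) (generalizedPentMinus 7 k))
                               (a7+-as-coefficient N (28 * pentMinus k))
    plusCoefficient : ∀ k → parity (plusTerm k) ≡ (P · q^ (28 * pentPlus (suc k))) N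
    plusCoefficient k = trans (cong (λ z → parity (a7+ (+ N ℤ.- z ℤ.- + 1))) (generalizedPentPlus 7 (suc k)))
                              (a7+-as-coefficient N (28 * pentPlus (suc k)))

  -- up to degree N these exponents are exactly those of pent 28 N (the last plus-exponent is > N)
  lhsExponents≈euler : ∀ N j → j ≤ N → lhsExponents N j ≡ euler 28 N j
  lhsExponents≈euler N j j≤N = begin
    Minus xor (xorSum N (λ k → (q^ (28 * pentPlus (suc k))) j) xor (q^ (28 * pentPlus (suc N))) j)
      ≡⟨ cong (λ b → Minus xor (xorSum N (λ k → (q^ (28 * pentPlus (suc k))) j) xor b)) (q^-≢ (28 * pentPlus (suc N)) j (<⇒≢ j<top)) ⟩
    Minus xor (xorSum N (λ k → (q^ (28 * pentPlus (suc k))) j) xor false)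
      ≡⟨ cong (Minus xor_) (xor-identityʳ _) ⟩
    Minus xor xorSum N (λ k → (q^ (28 * pentPlus (suc k))) j)
      ≡⟨ pent≡twoSums 28 N j ⟨
    pent 28 N j
      ≡⟨ euler≈pent-upTo 28 N j j≤N ⟨
    euler 28 N j ∎
    where
    open ≡-Reasoning
    Minus = xorSum (suc N) (λ k → (q^ (28 * pentMinus k)) j)
    j<top : j < 28 * pentPlus (suc N)
    j<top = <-≤-trans (s≤s j≤N) (≤-trans (pentPlus-large (suc N)) (m≤n*m (pentPlus (suc N)) 28))

  lhsSum-parity : ∀ N → parity (lhsSum (+ N)) ≡ pent 4 N N
  lhsSum-parity N = begin
    parity (lhsSum (+ N))              ≡⟨ lhsSum-as-coefficient N ⟩
    (etaProd N · lhsExponents N) N     ≡⟨ ·-cong-upTo (etaProd N) N (lhsExponents≈euler N) ⟩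
    (etaProd N · euler 28 N) N         ≡⟨ etaProd-·-euler N N ⟩
    euler 4 N N                        ≡⟨ euler≈pent-upTo 4 N N ≤-refl ⟩
    pent 4 N N                         ∎
    where open ≡-Reasoning

  -- for negative n every argument of a₇⁺ is < -1
  lhsSum-negative : ∀ N′ → parity (lhsSum -[1+ N′ ]) ≡ false
  lhsSum-negative N′ = trans (parity-+ (sumTo (2 + N′) minusTerm) (sumTo (2 + N′) plusTerm))
    (cong₂ _xor_ (trans (parity-sumTo (2 + N′) minusTerm) (xorSum-zero (2 + N′) (λ k _ → cong parity (vanishM k))))
                 (trans (parity-sumTo (2 + N′) plusTerm) (xorSum-zero (2 + N′) (λ k _ → cong parity (vanishP k)))))
    where
    minusTerm plusTerm : ℕ → ℤ
    minusTerm k = a7+ (-[1+ N′ ] ℤ.- penM k ℤ.- + 1)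
    plusTerm  k = a7+ (-[1+ N′ ] ℤ.- penP (suc k) ℤ.- + 1)
    vanishM : ∀ k → minusTerm k ≡ + 0
    vanishM k = trans (cong (λ z → a7+ (-[1+ N′ ] ℤ.- z ℤ.- + 1)) (generalizedPentMinus 7 k)) (a7+-negative N′ (28 * pentMinus k))
    vanishP : ∀ k → plusTerm k ≡ + 0
    vanishP k = trans (cong (λ z → a7+ (-[1+ N′ ] ℤ.- z ℤ.- + 1)) (generalizedPentPlus 7 (suc k))) (a7+-negative N′ (28 * pentPlus (suc k)))

  lhsSum-odd : ∀ N → pent 4 N N ≡ true → ¬ (+ 2 ℤ∣.∣ lhsSum (+ N))
  lhsSum-odd N pentN 2∣lhs = true≢false (trans (sym pentN) pentEven)
    where
    pentEven : pent 4 N N ≡ false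
    pentEven = trans (sym (lhsSum-parity N)) (2∣⇒¬odd ∣ lhsSum (+ N) ∣ 2∣lhs)
    true≢false : true ≢ false
    true≢false ()

  lhsSum-even : ∀ N → pent 4 N N ≡ false → + 2 ℤ∣.∣ lhsSum (+ N)
  lhsSum-even N pentN = ¬odd⇒2∣ ∣ lhsSum (+ N) ∣ (trans (lhsSum-parity N) pentN)

  lhsSum-even-negative : ∀ N′ → + 2 ℤ∣.∣ lhsSum -[1+ N′ ]
  lhsSum-even-negative N′ = ¬odd⇒2∣ ∣ lhsSum -[1+ N′ ] ∣ (lhsSum-negative N′)

  -- at n = 4A(l) and n = 4B(l) the coefficient of pent 4 is 1 (the truncation n ≥ l contains it)
  lhsSum-odd-at-pentMinus : ∀ l → ¬ (+ 2 ℤ∣.∣ lhsSum (+ (4 * pentMinus l)))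
  lhsSum-odd-at-pentMinus l = lhsSum-odd (4 * pentMinus l)
    (pent-at-pentMinus 4 (4 * pentMinus l) l (≤-trans (pentMinus-large l) (m≤n*m (pentMinus l) 4)))

  lhsSum-odd-at-pentPlus : ∀ l → ¬ (+ 2 ℤ∣.∣ lhsSum (+ (4 * pentPlus l)))
  lhsSum-odd-at-pentPlus zero    = lhsSum-odd 0 refl
  lhsSum-odd-at-pentPlus (suc k) = lhsSum-odd (4 * pentPlus (suc k))
    (pent-at-pentPlus 4 (4 * pentPlus (suc k)) (suc k) (s≤s z≤n) (≤-trans (pentPlus-large (suc k)) (m≤n*m (pentPlus (suc k)) 4)))

open import Defs
open import Data.Nat using (ℕ)
open import Data.Integer using (ℤ; +_; -[1+_]; _*_; _-_; _+_)
open import Data.Integer.Divisibility using (_∣_)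
open import Data.Product using (Σ; _×_; _,_)
open import Data.Sum using (_⊎_; inj₁; inj₂)
open import Relation.Binary.PropositionalEquality using (_≡_; sym; trans; cong; subst)
open import Relation.Nullary using (¬_)
open Reduction
  using ( generalizedPentMinus; generalizedPentPlus
        ; lhsSum-odd-at-pentMinus; lhsSum-odd-at-pentPlus; lhsSum-even; lhsSum-even-negative )
open PentagonalCoefficients using (pent-elsewhere)

GeneralizedPentagonal : ℤ → Set
GeneralizedPentagonal n = Σ ℕ (λ l → (n ≡ + 2 * + l * (+ 3 * + l - + 1)) ⊎ (n ≡ + 2 * + l * (+ 3 * + l + + 1)))

lhsSum-odd-at-pentagonal : ∀ n → GeneralizedPentagonal n → ¬ (+ 2 ∣ lhsSum n)
lhsSum-odd-at-pentagonal n (l , inj₁ n≡) =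
  subst (λ m → ¬ (+ 2 ∣ lhsSum m)) (sym (trans n≡ (generalizedPentMinus 1 l))) (lhsSum-odd-at-pentMinus l)
lhsSum-odd-at-pentagonal n (l , inj₂ n≡) =
  subst (λ m → ¬ (+ 2 ∣ lhsSum m)) (sym (trans n≡ (generalizedPentPlus 1 l))) (lhsSum-odd-at-pentPlus l)

lhsSum-even-elsewhere : ∀ n → ¬ GeneralizedPentagonal n → + 2 ∣ lhsSum n
lhsSum-even-elsewhere (+ N)     notPent = lhsSum-even N (pent-elsewhere 4 N N
  (λ l N≡ → notPent (l , inj₁ (trans (cong +_ N≡) (sym (generalizedPentMinus 1 l)))))
  (λ l N≡ → notPent (l , inj₂ (trans (cong +_ N≡) (sym (generalizedPentPlus 1 l))))))
lhsSum-even-elsewhere -[1+ N′ ] _       = lhsSum-even-negative N′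

lemma4p3 : (n : ℤ) →
    ((Σ ℕ (λ l → (n ≡ + 2 * + l * (+ 3 * + l - + 1)) ⊎ (n ≡ + 2 * + l * (+ 3 * + l + + 1)))) → ¬ (+ 2 ∣ lhsSum n))
    × ((¬ Σ ℕ (λ l → (n ≡ + 2 * + l * (+ 3 * + l - + 1)) ⊎ (n ≡ + 2 * + l * (+ 3 * + l + + 1)))) → + 2 ∣ lhsSum n)
lemma4p3 n = lhsSum-odd-at-pentagonal n , lhsSum-even-elsewhere n
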